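{- Algorithm 2 below, computing $\texttt{reconstruct\_journey}(u,v,t_1,t_2)$, runs in time $O(k\log\tau)$, where $k$ is the length (number of contacts) of the resulting journey. Algorithm 2: let $([t^-,t^+],w)=\textsc{find\_next}(u,v,t_1)$; if this is nil or $t^+>t_2$, return nil; otherwise set $\mathcal{J}\gets\langle(u,w,t^-)\rangle$ and, while $w\ne v$: let $([s,\cdot],w')=\textsc{find\_next}(w,v,t^-+\delta)$, append $(w,w',s)$ to $\mathcal{J}$, set $w\gets w'$ and $t^-\gets s$; finally return $\mathcal{J}$.
   Context: A temporal graph has vertex set $V$ with $|V|=n$, lifetime $[1,\tau]$ with integer timestamps, and constant latency $\delta\in\mathbb{N}$. The data structure is an $n\times n$ matrix whose entry $(x,y)$ points to a self-balancing BST $T(x,y)$ of depth $O(\log\tau)$ storing pairwise incomparable time intervals keyed by departure, each node also storing a successor vertex $w$ (meaning some journey from $x$ to $y$ with that departure and arrival starts with the contact $(x,w,t^-)$). $\textsc{find\_next}(x,y,s)$ returns the node of $T(x,y)$ whose interval $[t^-,t^+]$ has the earliest $t^-\ge s$, together with its successor (or nil), in $O(\log\tau)$ time. -}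

module Defs where

open import Data.Nat using (ℕ; zero; suc; _+_; _*_; _≤_; _<_; _<ᵇ_; _⊔_)
open import Data.Nat.Logarithm using (⌊log₂_⌋)
open import Data.Bool using (Bool; true; false; if_then_else_)
open import Data.Fin using (Fin; _≟_)
open import Data.List using (List; []; _∷_; _++_; [_]; length)
open import Data.List.Relation.Unary.AllPairs using (AllPairs)
open import Data.Maybe using (Maybe; just; nothing)
open import Data.Product using (_×_; _,_; proj₁; proj₂)
open import Relation.Nullary using (yes; no)

record Interval : Set where
  constructor [_,_]
  field
    dep : ℕ
    arr : ℕ
open Interval public

-- A node content of T(x,y): an interval together with a successor vertex w.
Entry : ℕ → Set
Entry n = Interval × Fin n

data Tree (n : ℕ) : Set where
  leaf : Tree n
  node : Tree n → Entry n → Tree n → Tree n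

depth : ∀ {n} → Tree n → ℕ
depth leaf         = 0
depth (node l _ r) = suc (depth l ⊔ depth r)

inorder : ∀ {n} → Tree n → List (Entry n)
inorder leaf         = []
inorder (node l e r) = inorder l ++ (e ∷ inorder r)

-- I strictly precedes J: earlier departure and earlier arrival.
-- For a list sorted by departure this is exactly pairwise incomparability
-- (no interval contains another).
Precedes : ∀ {n} → Entry n → Entry n → Set
Precedes (I , _) (J , _) = dep I < dep J × arr I < arr J

WellFormed : ∀ {n} → Tree n → Set
WellFormed t = AllPairs Precedes (inorder t)

-- find_next on a single tree, with its cost = number of tree positions
-- visited (at most depth + 1).  Returns the entry with the earliest
-- departure ≥ s (or nothing).
findTree : ∀ {n} → Tree n → ℕ → Maybe (Entry n) × ℕ
findTree leaf s = nothing , 1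
findTree (node l e r) s with dep (proj₁ e) <ᵇ s
... | true  = let (res , c) = findTree r s in res , suc c
... | false with findTree l s
...   | just e' , c  = just e' , suc c
...   | nothing , c  = just e , suc c

DS : ℕ → Set
DS n = Fin n → Fin n → Tree n

find-next : ∀ {n} → DS n → Fin n → Fin n → ℕ → Maybe (Entry n) × ℕ
find-next T x y s = findTree (T x y) s

Contact : ℕ → Set
Contact n = Fin n × Fin n × ℕ

-- Outcome of running the algorithm: either it finishes with a result
-- (nil = nothing, or a journey) and a total cost, or it does not finish
-- (fuel exhausted, or find_next unexpectedly returned nil in the loop).
data Run (n : ℕ) : Set where
  done  : Maybe (List (Contact n)) → ℕ → Run n
  stuck : Run n

-- Each iteration costs 1 (test w ≠ v, append, updates)
-- plus the cost of find_next; the final (failing) test costs 1.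
loop : ∀ {n} → ℕ → DS n → ℕ → Fin n → Fin n → ℕ → List (Contact n) → ℕ → Run n
loop zero       T δ v w t J c = stuck
loop (suc fuel) T δ v w t J c with w ≟ v
... | yes _ = done (just J) (suc c)
... | no  _ with find-next T w v (t + δ)
...   | nothing , c'            = stuck
...   | just ([ s , _ ] , w') , c' =
          loop fuel T δ v w' s (J ++ [ (w , w' , s) ]) (suc (c + c'))

reconstruct : ∀ {n} → ℕ → DS n → ℕ → Fin n → Fin n → ℕ → ℕ → Run n
reconstruct fuel T δ u v t₁ t₂ with find-next T u v t₁
... | nothing , c = done nothing (suc c)
... | just ([ t⁻ , t⁺ ] , w) , c =
        if t₂ <ᵇ t⁺
        then done nothing (suc c)
        else loop fuel T δ v w t⁻ [ (u , w , t⁻) ] (suc c)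

resultLength : ∀ {n} → Maybe (List (Contact n)) → ℕ
resultLength nothing  = 0
resultLength (just J) = length J

-- log τ, made ≥ 1 so that O(· log τ) is meaningful for τ = 1.
logτ : ℕ → ℕ
logτ τ = suc ⌊log₂ τ ⌋

-- Each call of find_next walks one root-to-leaf path, so it costs at most
-- depth + 1 = O(log τ).  Apart from a nil result (one call, k = 0), every
-- call of find_next contributes exactly one contact to the returned journey,
-- and every other step is O(1) per contact, so the total cost is O(k · log τ).
module Submission where

open import Defs
open import Data.Nat using (ℕ; zero; suc; _+_; _*_; _≤_; _<ᵇ_; s≤s; z≤n)
open import Data.Nat.Properties
  using (≤-refl; ≤-trans; m≤m⊔n; m≤n⊔m; m≤m+n; m≤n+m; +-suc; +-assoc;
         +-monoˡ-≤; +-monoʳ-≤; *-monoʳ-≤; *-commutativeSemigroup; module ≤-Reasoning)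
open import Algebra.Properties.CommutativeSemigroup *-commutativeSemigroup
  using (x∙yz≈y∙xz)
open import Data.Fin using (Fin; _≟_)
open import Data.Maybe using (Maybe; just; nothing)
open import Data.List using (List; []; _∷_; _++_; [_]; length)
open import Data.List.Properties using (++-identityʳ; ++-assoc)
open import Data.Product using (∃; _×_; _,_; proj₁; proj₂)
open import Data.Bool using (true; false)
open import Relation.Nullary using (yes; no)
open import Relation.Binary.PropositionalEquality using (_≡_; refl; sym; cong)

findTree-cost≤1+depth : ∀ {n} (t : Tree n) s → proj₂ (findTree t s) ≤ suc (depth t)
findTree-cost≤1+depth leaf s = ≤-refl
findTree-cost≤1+depth (node l e r) s with dep (proj₁ e) <ᵇ s
... | true  = s≤s (≤-trans (findTree-cost≤1+depth r s) (s≤s (m≤n⊔m (depth l) (depth r))))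
... | false with findTree l s | findTree-cost≤1+depth l s
...   | just _  , _ | c≤ = s≤s (≤-trans c≤ (s≤s (m≤m⊔n (depth l) (depth r))))
...   | nothing , _ | c≤ = s≤s (≤-trans c≤ (s≤s (m≤m⊔n (depth l) (depth r))))

FindNextCost≤ : ∀ {n} → DS n → ℕ → Set
FindNextCost≤ T B = ∀ x y s → proj₂ (find-next T x y s) ≤ B

find-next-cost≤1+depth : ∀ {n} {T : DS n} {d} →
  (∀ x y → depth (T x y) ≤ d) → FindNextCost≤ T (suc d)
find-next-cost≤1+depth {T = T} depth≤ x y s =
  ≤-trans (findTree-cost≤1+depth (T x y) s) (s≤s (depth≤ x y))

private
  step-cost : ∀ {c c' B} m → c' ≤ B → suc (suc (c + c')) + m ≤ suc c + (suc B + m)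
  step-cost {c} {c'} {B} m c'≤B = begin
    suc (suc (c + c')) + m  ≤⟨ +-monoˡ-≤ m (s≤s (s≤s (+-monoʳ-≤ c c'≤B))) ⟩
    suc (suc (c + B + m))   ≡⟨ cong (λ k → suc (suc k)) (+-assoc c B m) ⟩
    suc (suc (c + (B + m))) ≡⟨ cong suc (sym (+-suc c (B + m))) ⟩
    suc c + (suc B + m)     ∎
    where open ≤-Reasoning

loop-cost : ∀ {n} {T : DS n} {δ B} → FindNextCost≤ T B →
  ∀ fuel v w t J c {res cost} → loop fuel T δ v w t J c ≡ done res cost →
  ∃ λ K → res ≡ just (J ++ K) × cost ≤ suc c + length K * suc B
loop-cost bound zero v w t J c ()
loop-cost bound (suc fuel) v w t J c eq with w ≟ v
... | yes _ with eq
...   | refl = [] , cong just (sym (++-identityʳ J)) , m≤m+n _ _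
loop-cost {T = T} {δ} bound (suc fuel) v w t J c eq | no _
  with find-next T w v (t + δ) | bound w v (t + δ)
... | nothing , _ | _ with eq
...   | ()
loop-cost bound (suc fuel) v w t J c eq | no _
    | just ([ s , _ ] , w') , c' | c'≤B
  with loop-cost bound fuel v w' s (J ++ [ (w , w' , s) ]) (suc (c + c')) eq
... | K , refl , cost≤ =
  (w , w' , s) ∷ K , cong just (++-assoc J _ K) , ≤-trans cost≤ (step-cost _ c'≤B)

reconstruct-cost : ∀ {n} {T : DS n} {δ B} → FindNextCost≤ T B →
  ∀ u v t₁ t₂ fuel {res cost} → reconstruct fuel T δ u v t₁ t₂ ≡ done res cost →
  cost ≤ suc (resultLength res) * suc B
reconstruct-cost {T = T} bound u v t₁ t₂ fuel eq
  with find-next T u v t₁ | bound u v t₁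
... | nothing , _ | c≤B with eq
...   | refl = ≤-trans (s≤s c≤B) (m≤m+n _ _)
reconstruct-cost bound u v t₁ t₂ fuel eq
    | just ([ t⁻ , t⁺ ] , w) , c | c≤B with t₂ <ᵇ t⁺
... | true with eq
...   | refl = ≤-trans (s≤s c≤B) (m≤m+n _ _)
reconstruct-cost {B = B} bound u v t₁ t₂ fuel {cost = cost} eq
    | just ([ t⁻ , t⁺ ] , w) , c | c≤B | false
  with loop-cost bound fuel v w t⁻ [ (u , w , t⁻) ] (suc c) eq
... | K , refl , cost≤ = begin
    cost                              ≤⟨ cost≤ ⟩
    suc (suc c) + m                   ≤⟨ +-monoˡ-≤ m (s≤s (s≤s c≤B)) ⟩
    1 + (suc B + m)                   ≤⟨ +-monoˡ-≤ (suc B + m) (s≤s z≤n) ⟩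
    suc (suc (length K)) * suc B      ∎
  where
  open ≤-Reasoning
  m = length K * suc B

2+a*l≤[2+a]*l : ∀ a l → 2 + a * suc l ≤ (2 + a) * suc l
2+a*l≤[2+a]*l a l = s≤s (≤-trans (s≤s (m≤n+m _ l)) (m≤n+m _ l))

theorem2 : (c₀ : ℕ) → ∃ λ c →
    ∀ {n} (τ δ : ℕ) (T : DS n) →
    (∀ x y → WellFormed (T x y)) →
    (∀ x y → depth (T x y) ≤ c₀ * logτ τ) →
    ∀ (u v : Fin n) (t₁ t₂ fuel : ℕ) (res : Maybe (List (Contact n))) (cost : ℕ) →
    reconstruct fuel T δ u v t₁ t₂ ≡ done res cost →
    cost ≤ c * (suc (resultLength res) * logτ τ)
-- Well-formedness of the trees matters for the correctness of find_next, not for its cost.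
theorem2 c₀ = 2 + c₀ , λ τ δ T _ depth≤ u v t₁ t₂ fuel res cost eq →
  let k = suc (resultLength res) in begin
    cost                            ≤⟨ reconstruct-cost {T = T} {δ} (find-next-cost≤1+depth depth≤) u v t₁ t₂ fuel eq ⟩
    k * (2 + c₀ * logτ τ)           ≤⟨ *-monoʳ-≤ k (2+a*l≤[2+a]*l c₀ _) ⟩
    k * ((2 + c₀) * logτ τ)         ≡⟨ x∙yz≈y∙xz k (2 + c₀) (logτ τ) ⟩
    (2 + c₀) * (k * logτ τ)         ∎
  where open ≤-Reasoning
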